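{- For every finite simple graph $G$, the number of inclusion minimal independent sets $S \subseteq V(G)$ with $d(S) > 0$ is greater than or equal to $d_c(G)$.
   Context: Let $G$ be a finite simple graph. For $A \subseteq V(G)$, $N(A)$ denotes the set of all vertices adjacent to some vertex of $A$. For $X \subseteq V(G)$, the difference of $X$ is $d(X) = |X| - |N(X)|$, and the critical difference is $d_c(G) = \max\{d(X) : X \subseteq V(G)\}$. An independent set $S$ with $d(S) > 0$ is called an inclusion minimal (independent) set with $d(S)>0$ if no proper subset of $S$ has positive difference. -}

module Defs where

open import Data.Nat using (ℕ; zero; suc)
open import Data.Bool using (Bool; true; false)
open import Data.Fin using (Fin)
open import Data.Fin.Subset using (Subset; inside; outside; _∈_; _⊂_; ∣_∣)
open import Data.Fin.Subset.Properties using (_∈?_; _⊂?_; anySubset?)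
open import Data.Fin.Properties using (any?; all?)
open import Data.Vec using ([]; _∷_; tabulate; map; _++_)
open import Data.List as List using (List; length; filter; foldr)
open import Data.Integer as ℤ using (ℤ; +_; _-_; _⊔_; _<_; _<?_)
open import Data.Product using (_×_; _,_; ∃; proj₁; proj₂)
open import Relation.Nullary using (¬_; Dec; yes; no)
open import Relation.Nullary.Decidable using (_×-dec_; ¬?; map′)
open import Relation.Binary.PropositionalEquality using (_≡_; refl)
open import Data.Bool.Properties using () renaming (_≟_ to _≟B_)

record Graph (n : ℕ) : Set where
  field
    edge   : Fin n → Fin n → Bool
    sym    : ∀ u v → edge u v ≡ edge v u
    irrefl : ∀ v → edge v v ≡ false

open Graph public

Adj : ∀ {n} → Graph n → Fin n → Fin n → Set
Adj G u v = edge G u v ≡ true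

N : ∀ {n} → Graph n → Subset n → Subset n
N G A = tabulate λ v → Dec→side (any? λ u → (u ∈? A) ×-dec (edge G u v ≟B true))
  where
  Dec→side : ∀ {P : Set} → Dec P → Bool
  Dec→side (yes _) = inside
  Dec→side (no _)  = outside

d : ∀ {n} → Graph n → Subset n → ℤ
d G X = + ∣ X ∣ - + ∣ N G X ∣

allSubsets : (n : ℕ) → List (Subset n)
allSubsets zero    = List.[ [] ]
allSubsets (suc n) = List.map (inside ∷_) (allSubsets n) List.++ List.map (outside ∷_) (allSubsets n)

dc : ∀ {n} → Graph n → ℤ
dc {n} G = foldr (λ X m → d G X ⊔ m) (d G (tabulate λ _ → outside)) (allSubsets n)

Independent : ∀ {n} → Graph n → Subset n → Set
Independent G S = ∀ u v → u ∈ S → v ∈ S → ¬ Adj G u v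

MinimalPositive : ∀ {n} → Graph n → Subset n → Set
MinimalPositive G S =
  Independent G S × (+ 0 < d G S) × (∀ T → T ⊂ S → ¬ (+ 0 < d G T))

independent? : ∀ {n} (G : Graph n) S → Dec (Independent G S)
independent? G S = all? λ u → all? λ v → uv u v
  where
  uv : ∀ u v → Dec (u ∈ S → v ∈ S → ¬ Adj G u v)
  uv u v with u ∈? S | v ∈? S | edge G u v ≟B true
  ... | no ¬p | _ | _ = yes λ p → Data.Empty.⊥-elim (¬p p)
    where import Data.Empty
  ... | yes p | no ¬q | _ = yes λ _ q → Data.Empty.⊥-elim (¬q q)
    where import Data.Empty
  ... | yes p | yes q | yes e = no λ f → f p q e
  ... | yes p | yes q | no ¬e = yes λ _ _ → ¬e

minimalPositive? : ∀ {n} (G : Graph n) S → Dec (MinimalPositive G S)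
minimalPositive? G S =
  independent? G S ×-dec ((+ 0 <? d G S) ×-dec
    map′ (λ ¬ex T T⊂S pos → ¬ex (T , T⊂S , pos))
         (λ all (T , T⊂S , pos) → all T T⊂S pos)
         (¬? (anySubset? λ T → (T ⊂? S) ×-dec (+ 0 <? d G T))))

numMinimalPositive : ∀ {n} → Graph n → ℕ
numMinimalPositive {n} G = length (filter (minimalPositive? G) (allSubsets n))

-- Every set X with d(X) > 0 contains an inclusion-minimal such set S, and S is
-- independent: if two vertices of S were adjacent, the vertices Y of S with no
-- neighbour in A = S ∩ N(S) would form a proper subset with d(Y) > 0, because
-- N(Y) and A are disjoint subsets of N(S) while S ∖ Y ⊆ A. Deleting a vertex of
-- such an S from X loses at least one minimal set inside X and does not enlarge
-- N(X), so by induction |X| ≤ #{minimal S ⊆ X} + |N(X)|.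
module Submission where

open import Defs
open import Data.Nat using (ℕ)
open import Data.Integer using (+_; _≤_)

open import Data.Nat as ℕ using (suc; _+_)
import Data.Nat.Properties as ℕ
open import Data.Nat.Induction using (<-wellFounded)
import Data.Integer as ℤ
import Data.Integer.Properties as ℤ
open import Data.Bool using (true)
open import Data.Bool.Properties using () renaming (_≟_ to _≟B_)
open import Data.Fin using (Fin)
open import Data.Fin.Properties using (any?)
open import Data.Fin.Subset
  using (Subset; inside; outside; _∈_; _∉_; _⊆_; _⊂_; ∣_∣; _∩_; _─_; _-_; ⁅_⁆; Nonempty)
open import Data.Fin.Subset.Properties
  using ( _∈?_; _⊆?_; _⊂?_; anySubset?; nonempty?; Empty-unique; ∣⊥∣≡0
        ; p⊆q⇒∣p∣≤∣q∣; p⊂q⇒∣p∣<∣q∣; p⊂q⇒p⊆q; ⊆-trans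
        ; x∈p∩q⁺; x∈p∩q⁻; p∩q⊆p; p∩q⊆q; ∣p∩q∣≤∣q∣; p─q⊆p; x∈p∧x∉q⇒x∈p─q
        ; x∈⁅x⁆; ∣⁅x⁆∣≡1; x∈p⇒p-x⊂p )
open import Data.Vec using ([]; _∷_; lookup; here; there)
open import Data.Vec.Properties using (lookup∘tabulate; []=⇒lookup; lookup⇒[]=)
open import Data.List as List using (length; filter; foldr)
open import Data.List.Relation.Unary.Any using (here; there)
open import Data.List.Membership.Propositional using () renaming (_∈_ to _∈ₗ_)
open import Data.List.Membership.Propositional.Properties using (∈-map⁺; ∈-++⁺ˡ; ∈-++⁺ʳ)
open import Data.List.Relation.Binary.Sublist.Heterogeneous.Properties
  using (length-mono-≤; ⊆-filter-Sublist)
open import Data.List.Relation.Binary.Sublist.Propositional using (⊆-refl)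
open import Data.Product using (_×_; _,_; ∃-syntax; proj₁; proj₂)
open import Function using (id; _∘_)
open import Induction.WellFounded using (WellFounded; Acc; acc; module Subrelation)
import Relation.Binary.Construct.On as On
open import Relation.Nullary using (¬_; Dec; yes; no; contradiction)
open import Relation.Nullary.Decidable using (_×-dec_)
open import Relation.Unary using (Decidable)
open import Relation.Binary.PropositionalEquality using (_≡_; refl; trans; cong)
import Relation.Binary.PropositionalEquality as ≡

x∈p─q⇒x∉q : ∀ {n} (p q : Subset n) {x} → x ∈ p ─ q → x ∉ q
x∈p─q⇒x∉q (inside ∷ p) (outside ∷ q) here ()
x∈p─q⇒x∉q (_ ∷ p) (_ ∷ q) (there x∈p─q) (there x∈q) = x∈p─q⇒x∉q p q x∈p─q x∈q

∣p∣≡∣p∩q∣+∣p─q∣ : ∀ {n} (p q : Subset n) → ∣ p ∣ ≡ ∣ p ∩ q ∣ + ∣ p ─ q ∣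
∣p∣≡∣p∩q∣+∣p─q∣ [] [] = refl
∣p∣≡∣p∩q∣+∣p─q∣ (inside ∷ p) (inside ∷ q) = cong suc (∣p∣≡∣p∩q∣+∣p─q∣ p q)
∣p∣≡∣p∩q∣+∣p─q∣ (inside ∷ p) (outside ∷ q) =
  trans (cong suc (∣p∣≡∣p∩q∣+∣p─q∣ p q)) (≡.sym (ℕ.+-suc _ _))
∣p∣≡∣p∩q∣+∣p─q∣ (outside ∷ p) (inside ∷ q) = ∣p∣≡∣p∩q∣+∣p─q∣ p q
∣p∣≡∣p∩q∣+∣p─q∣ (outside ∷ p) (outside ∷ q) = ∣p∣≡∣p∩q∣+∣p─q∣ p q

∣p∣≤1+∣p-x∣ : ∀ {n} (p : Subset n) (x : Fin n) → ∣ p ∣ ℕ.≤ suc ∣ p - x ∣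
∣p∣≤1+∣p-x∣ p x = begin
  ∣ p ∣                          ≡⟨ ∣p∣≡∣p∩q∣+∣p─q∣ p ⁅ x ⁆ ⟩
  (∣ p ∩ ⁅ x ⁆ ∣ + ∣ p - x ∣)    ≤⟨ ℕ.+-monoˡ-≤ ∣ p - x ∣ (∣p∩q∣≤∣q∣ p ⁅ x ⁆) ⟩
  (∣ ⁅ x ⁆ ∣ + ∣ p - x ∣)        ≡⟨ cong (_+ ∣ p - x ∣) (∣⁅x⁆∣≡1 x) ⟩
  suc ∣ p - x ∣                  ∎
  where open ℕ.≤-Reasoning

disjoint⇒∣p∣+∣q∣≤∣r∣ : ∀ {n} {p q r : Subset n} → (∀ {x} → x ∈ p → x ∉ q) →
                       p ⊆ r → q ⊆ r → ∣ p ∣ + ∣ q ∣ ℕ.≤ ∣ r ∣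
disjoint⇒∣p∣+∣q∣≤∣r∣ {p = p} {q} {r} p∩q≡∅ p⊆r q⊆r = begin
  (∣ p ∣ + ∣ q ∣)            ≤⟨ ℕ.+-mono-≤ (p⊆q⇒∣p∣≤∣q∣ p⊆r∩p) (p⊆q⇒∣p∣≤∣q∣ q⊆r─p) ⟩
  (∣ r ∩ p ∣ + ∣ r ─ p ∣)    ≡⟨ ∣p∣≡∣p∩q∣+∣p─q∣ r p ⟨
  ∣ r ∣                      ∎
  where
  open ℕ.≤-Reasoning
  p⊆r∩p : p ⊆ r ∩ p
  p⊆r∩p x∈p = x∈p∩q⁺ (p⊆r x∈p , x∈p)
  q⊆r─p : q ⊆ r ─ p
  q⊆r─p x∈q = x∈p∧x∉q⇒x∈p─q (q⊆r x∈q) (λ x∈p → p∩q≡∅ x∈p x∈q)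

0<∣p∣⇒nonempty : ∀ {n} (p : Subset n) → 0 ℕ.< ∣ p ∣ → Nonempty p
0<∣p∣⇒nonempty {n} p 0<∣p∣ with nonempty? p
... | yes p≢∅ = p≢∅
... | no  p≡∅ = contradiction (trans (cong ∣_∣ (Empty-unique p≡∅)) (∣⊥∣≡0 n)) (ℕ.n>0⇒n≢0 0<∣p∣)

⊂-wellFounded : ∀ {n} → WellFounded (_⊂_ {n})
⊂-wellFounded = Subrelation.wellFounded p⊂q⇒∣p∣<∣q∣ (On.wellFounded ∣_∣ <-wellFounded)

Minimal : ∀ {n} → (Subset n → Set) → Subset n → Set
Minimal P S = P S × (∀ T → T ⊂ S → ¬ P T)

minimal⊆ : ∀ {n} {P : Subset n → Set} → Decidable P → ∀ Y → P Y → ∃[ S ] S ⊆ Y × Minimal P S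
minimal⊆ {P = P} P? Y = go Y (⊂-wellFounded Y)
  where
  go : ∀ Y → Acc _⊂_ Y → P Y → ∃[ S ] S ⊆ Y × Minimal P S
  go Y (acc rec) pY with anySubset? (λ T → (T ⊂? Y) ×-dec P? T)
  ... | no ∄T = Y , id , pY , λ T T⊂Y pT → ∄T (T , T⊂Y , pT)
  ... | yes (T , T⊂Y , pT) with go T (rec T⊂Y) pT
  ...   | S , S⊆T , minS = S , ⊆-trans S⊆T (p⊂q⇒p⊆q T⊂Y) , minS

module _ {A : Set} {P Q : A → Set} (P? : Decidable P) (Q? : Decidable Q)
         (P⇒Q : ∀ {x} → P x → Q x) where

  length-filter-mono : ∀ xs → length (filter P? xs) ℕ.≤ length (filter Q? xs)
  length-filter-mono xs = length-mono-≤ (⊆-filter-Sublist P? Q? (λ { refl → P⇒Q }) (⊆-refl {x = xs}))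

  length-filter-mono-< : ∀ {y} xs → y ∈ₗ xs → Q y → ¬ P y →
                         length (filter P? xs) ℕ.< length (filter Q? xs)
  length-filter-mono-< (x List.∷ xs) (here refl) qx ¬px with P? x | Q? x
  ... | yes px | _     = contradiction px ¬px
  ... | no _   | yes _ = ℕ.s≤s (length-filter-mono xs)
  ... | no _   | no ¬q = contradiction qx ¬q
  length-filter-mono-< (x List.∷ xs) (there y∈xs) qy ¬py with P? x | Q? x
  ... | yes px | no ¬qx = contradiction (P⇒Q px) ¬qx
  ... | yes _  | yes _  = ℕ.s≤s (length-filter-mono-< xs y∈xs qy ¬py)
  ... | no _   | yes _  = ℕ.m≤n⇒m≤1+n (length-filter-mono-< xs y∈xs qy ¬py)
  ... | no _   | no _   = length-filter-mono-< xs y∈xs qy ¬py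

∈-allSubsets : ∀ {n} (S : Subset n) → S ∈ₗ allSubsets n
∈-allSubsets [] = here refl
∈-allSubsets (inside ∷ S) = ∈-++⁺ˡ (∈-map⁺ (inside ∷_) (∈-allSubsets S))
∈-allSubsets {suc n} (outside ∷ S) =
  ∈-++⁺ʳ (List.map (inside ∷_) (allSubsets n)) (∈-map⁺ (outside ∷_) (∈-allSubsets S))

0<m-n⇒n<m : ∀ {m n} → + 0 ℤ.< + m ℤ.- + n → n ℕ.< m
0<m-n⇒n<m {m} {n} 0<m-n with n ℕ.<? m
... | yes n<m = n<m
... | no  n≮m = contradiction 0<m-n (ℤ.≤⇒≯ (ℤ.i≤j⇒i-j≤0 (ℤ.+≤+ (ℕ.≮⇒≥ n≮m))))

n<m⇒0<m-n : ∀ {m n} → n ℕ.< m → + 0 ℤ.< + m ℤ.- + n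
n<m⇒0<m-n {m} {n} n<m = begin-strict
  + 0         ≡⟨ ℤ.n⊖n≡0 n ⟨
  n ℤ.⊖ n     <⟨ ℤ.⊖-monoˡ-< n n<m ⟩
  m ℤ.⊖ n     ≡⟨ ℤ.[+m]-[+n]≡m⊖n m n ⟨
  + m ℤ.- + n ∎
  where open ℤ.≤-Reasoning

m≤o+n⇒m-n≤o : ∀ {m n o} → m ℕ.≤ o + n → + m ℤ.- + n ℤ.≤ + o
m≤o+n⇒m-n≤o {m} {n} {o} m≤o+n = begin
  + m ℤ.- + n       ≡⟨ ℤ.[+m]-[+n]≡m⊖n m n ⟩
  m ℤ.⊖ n           ≤⟨ ℤ.⊖-monoˡ-≤ n m≤o+n ⟩
  (o + n) ℤ.⊖ n     ≡⟨ ℤ.≤-⊖ (ℕ.m≤n+m n o) ⟩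
  + (o + n ℕ.∸ n)   ≡⟨ cong +_ (ℕ.m+n∸n≡m o n) ⟩
  + o               ∎
  where open ℤ.≤-Reasoning

foldr-⊔-≤ : ∀ {A : Set} (f : A → ℤ.ℤ) {e c} → e ℤ.≤ c → (∀ x → f x ℤ.≤ c) →
            ∀ xs → foldr (λ x m → f x ℤ.⊔ m) e xs ℤ.≤ c
foldr-⊔-≤ f e≤c f≤c List.[]       = e≤c
foldr-⊔-≤ f e≤c f≤c (x List.∷ xs) = ℤ.⊔-lub (f≤c x) (foldr-⊔-≤ f e≤c f≤c xs)

module _ {n : ℕ} (G : Graph n) where

  -- N G A tabulates a decision, so membership unfolds to the outcome of that same any? call.
  x∈N⁻ : ∀ {A v} → v ∈ N G A → ∃[ u ] u ∈ A × Adj G u v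
  x∈N⁻ {A} {v} v∈NA
    with any? (λ u → (u ∈? A) ×-dec (edge G u v ≟B true))
       | trans (≡.sym (lookup∘tabulate _ v)) ([]=⇒lookup v∈NA)
  ... | yes u∈A∧uv | _ = u∈A∧uv
  ... | no  _      | ()

  x∈N⁺ : ∀ {A u v} → u ∈ A → Adj G u v → v ∈ N G A
  x∈N⁺ {A} {u} {v} u∈A uv with lookup (N G A) v in v∈?NA
  ... | inside  = lookup⇒[]= v (N G A) v∈?NA
  ... | outside
    with any? (λ u → (u ∈? A) ×-dec (edge G u v ≟B true))
       | trans (≡.sym (lookup∘tabulate _ v)) v∈?NA
  ...   | yes _ | ()
  ...   | no ∄u | _ = contradiction (u , u∈A , uv) ∄u

  N-mono : ∀ {X Y} → X ⊆ Y → N G X ⊆ N G Y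
  N-mono X⊆Y v∈NX with x∈N⁻ v∈NX
  ... | u , u∈X , uv = x∈N⁺ (X⊆Y u∈X) uv

  Surplus : Subset n → Set
  Surplus X = ∣ N G X ∣ ℕ.< ∣ X ∣

  surplus? : Decidable Surplus
  surplus? X = ∣ N G X ∣ ℕ.<? ∣ X ∣

  minimalSurplus⇒independent : ∀ {S} → Minimal Surplus S → Independent G S
  minimalSurplus⇒independent {S} (surplusS , minimal) u w u∈S w∈S uw =
    minimal Y Y⊂S surplusY
    where
    A = S ∩ N G S
    Y = S ─ N G A

    u∈A : u ∈ A
    u∈A = x∈p∩q⁺ (u∈S , x∈N⁺ w∈S (trans (Graph.sym G w u) uw))

    Y⊂S : Y ⊂ S
    Y⊂S = p─q⊆p S (N G A) , w , w∈S , λ w∈Y → x∈p─q⇒x∉q S (N G A) w∈Y (x∈N⁺ u∈A uw)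

    S∩NA⊆A : S ∩ N G A ⊆ A
    S∩NA⊆A x∈S∩NA with x∈p∩q⁻ S (N G A) x∈S∩NA
    ... | x∈S , x∈NA with x∈N⁻ x∈NA
    ...   | a , a∈A , ax = x∈p∩q⁺ (x∈S , x∈N⁺ (p∩q⊆p S (N G S) a∈A) ax)

    A∩NY≡∅ : ∀ {x} → x ∈ A → x ∉ N G Y
    A∩NY≡∅ {x} x∈A x∈NY with x∈N⁻ x∈NY
    ... | y , y∈Y , yx = x∈p─q⇒x∉q S (N G A) y∈Y (x∈N⁺ x∈A (trans (Graph.sym G x y) yx))

    surplusY : Surplus Y
    surplusY = ℕ.+-cancelˡ-< ∣ A ∣ _ _ (begin-strict
      (∣ A ∣ + ∣ N G Y ∣)      ≤⟨ disjoint⇒∣p∣+∣q∣≤∣r∣ A∩NY≡∅ (p∩q⊆q S (N G S))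
                                    (N-mono (p─q⊆p S (N G A))) ⟩
      ∣ N G S ∣                <⟨ surplusS ⟩
      ∣ S ∣                    ≡⟨ ∣p∣≡∣p∩q∣+∣p─q∣ S (N G A) ⟩
      (∣ S ∩ N G A ∣ + ∣ Y ∣)  ≤⟨ ℕ.+-monoˡ-≤ ∣ Y ∣ (p⊆q⇒∣p∣≤∣q∣ S∩NA⊆A) ⟩
      (∣ A ∣ + ∣ Y ∣)          ∎)
      where open ℕ.≤-Reasoning

  minimalSurplus⇒minimalPositive : ∀ {S} → Minimal Surplus S → MinimalPositive G S
  minimalSurplus⇒minimalPositive minS@(surplusS , minimal) =
    minimalSurplus⇒independent minS , n<m⇒0<m-n surplusS ,
    λ T T⊂S → minimal T T⊂S ∘ 0<m-n⇒n<m

  minimalPositive⊆? : (X S : Subset n) → Dec (MinimalPositive G S × S ⊆ X)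
  minimalPositive⊆? X S = minimalPositive? G S ×-dec (S ⊆? X)

  #minimalPositive⊆ : Subset n → ℕ
  #minimalPositive⊆ X = length (filter (minimalPositive⊆? X) (allSubsets n))

  #minimalPositive⊆≤numMinimalPositive : ∀ X → #minimalPositive⊆ X ℕ.≤ numMinimalPositive G
  #minimalPositive⊆≤numMinimalPositive X =
    length-filter-mono (minimalPositive⊆? X) (minimalPositive? G) proj₁ (allSubsets n)

  #minimalPositive⊆-mono-< : ∀ {X Y S} → Y ⊆ X → MinimalPositive G S → S ⊆ X → ¬ S ⊆ Y →
                             #minimalPositive⊆ Y ℕ.< #minimalPositive⊆ X
  #minimalPositive⊆-mono-< {X} {Y} {S} Y⊆X minS S⊆X S⊈Y =
    length-filter-mono-< (minimalPositive⊆? Y) (minimalPositive⊆? X)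
      (λ (minT , T⊆Y) → minT , ⊆-trans T⊆Y Y⊆X)
      (allSubsets n) (∈-allSubsets S) (minS , S⊆X) (S⊈Y ∘ proj₂)

  ∣X∣≤#minimalPositive⊆X+∣NX∣ : ∀ X → ∣ X ∣ ℕ.≤ #minimalPositive⊆ X + ∣ N G X ∣
  ∣X∣≤#minimalPositive⊆X+∣NX∣ X = go X (⊂-wellFounded X)
    where
    go : ∀ X → Acc _⊂_ X → ∣ X ∣ ℕ.≤ #minimalPositive⊆ X + ∣ N G X ∣
    go X (acc rec) with surplus? X
    ... | no ¬surplusX = ℕ.≤-trans (ℕ.≮⇒≥ ¬surplusX) (ℕ.m≤n+m _ _)
    ... | yes surplusX with minimal⊆ surplus? X surplusX
    ...   | S , S⊆X , minS@(surplusS , _) with 0<∣p∣⇒nonempty S (ℕ.≤-<-trans ℕ.z≤n surplusS)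
    ...     | v , v∈S = begin
      ∣ X ∣                                            ≤⟨ ∣p∣≤1+∣p-x∣ X v ⟩
      suc ∣ X - v ∣                                    ≤⟨ ℕ.s≤s (go (X - v) (rec X-v⊂X)) ⟩
      suc (#minimalPositive⊆ (X - v) + ∣ N G (X - v) ∣) ≤⟨ ℕ.+-mono-≤ #X-v<#X ∣NX-v∣≤∣NX∣ ⟩
      #minimalPositive⊆ X + ∣ N G X ∣                  ∎
      where
      open ℕ.≤-Reasoning
      X-v⊂X : X - v ⊂ X
      X-v⊂X = x∈p⇒p-x⊂p (S⊆X v∈S)
      #X-v<#X : #minimalPositive⊆ (X - v) ℕ.< #minimalPositive⊆ X
      #X-v<#X = #minimalPositive⊆-mono-< (p⊂q⇒p⊆q X-v⊂X) (minimalSurplus⇒minimalPositive minS) S⊆X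
        λ S⊆X-v → x∈p─q⇒x∉q X ⁅ v ⁆ (S⊆X-v v∈S) (x∈⁅x⁆ v)
      ∣NX-v∣≤∣NX∣ : ∣ N G (X - v) ∣ ℕ.≤ ∣ N G X ∣
      ∣NX-v∣≤∣NX∣ = p⊆q⇒∣p∣≤∣q∣ (N-mono (p⊂q⇒p⊆q X-v⊂X))

  d≤numMinimalPositive : ∀ X → d G X ℤ.≤ + numMinimalPositive G
  d≤numMinimalPositive X = m≤o+n⇒m-n≤o (ℕ.≤-trans (∣X∣≤#minimalPositive⊆X+∣NX∣ X)
    (ℕ.+-monoˡ-≤ ∣ N G X ∣ (#minimalPositive⊆≤numMinimalPositive X)))

corollary2p13 : ∀ {n : ℕ} (G : Graph n) → dc G ≤ + numMinimalPositive G
corollary2p13 {n} G =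
  foldr-⊔-≤ (d G) (d≤numMinimalPositive G _) (d≤numMinimalPositive G) (allSubsets n)
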